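{- Let $I\subseteq\omega$ be infinite and $\mathcal F$ a non-principal ultrafilter on $I$. Then the ultraproduct $\prod_{n\in I}\underline{E}^{\{1,3\}}_{n+1}/\mathcal F$ embeds into the algebra $\underline{E}^{\{1,3\}}_{2^\omega}$ whose set of atoms is $\prod_{n\in I}\mathrm{At}\,\underline{E}^{\{1,3\}}_{n+1}/\mathcal F$ (with identity atom the class of the function $n\mapsto 1'$ of $\underline{E}^{\{1,3\}}_{n+1}$).
   Context: For a set $D$ of "diversity atoms" and a new element $1'\notin D$, the algebra $\underline{E}^{\{1,3\}}$ on atom set $\{1'\}\cup D$ is the complete atomic relation algebra whose universe is the power set of $\{1'\}\cup D$ (with $+$ union, $-$ complement, identity $\{1'\}$), conversion is the identity map, and composition is the completely additive extension of the following table on atoms: $1';x=x;1'=x$; for $a\in D$, $a;a=1'+a$; for distinct $a,b\in D$, $a;b=\sum\{c\in D: c\neq a,\ c\neq b\}$. $\underline{E}^{\{1,3\}}_{n+1}$ denotes this algebra with $|D|=n$ (so $n+1$ atoms), and $\underline{E}^{\{1,3\}}_{2^\omega}$ one with $|D|=2^{\aleph_0}$. $\mathrm{At}$ denotes the set of atoms. The ultraproduct of algebras $\prod_{n\in I}\underline{A}_n/\mathcal F$ has operations defined pointwise on representatives, with $f\sim_{\mathcal F}g$ iff $\{n:f(n)=g(n)\}\in\mathcal F$. -}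

module Defs where

open import Level using (0ℓ)
open import Data.Bool using (Bool; T)
open import Data.Nat using (ℕ; _≤_)
open import Data.Fin using (Fin; zero)
open import Data.Product using (Σ; ∃; _×_; _,_; proj₁; proj₂)
open import Data.Sum using (_⊎_; inj₁; inj₂; map)
open import Data.Unit using (⊤; tt)
open import Data.Empty using (⊥)
open import Relation.Nullary using (¬_)
open import Relation.Binary.Bundles using (Setoid)
open import Relation.Binary.PropositionalEquality as ≡ using (_≡_)

record Ultrafilter (J : Set) : Set₁ where
  field
    member : (J → Set) → Set
    mono   : ∀ {X Y : J → Set} → (∀ j → X j → Y j) → member X → member Y
    inter  : ∀ {X Y : J → Set} → member X → member Y → member (λ j → X j × Y j)
    full   : member (λ _ → ⊤)
    proper : ¬ member (λ _ → ⊥)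
    ultra  : ∀ (X : J → Set) → member X ⊎ member (λ j → ¬ X j)

NonPrincipal : ∀ {J : Set} → Ultrafilter J → Set
NonPrincipal {J} U = ∀ (j : J) → ¬ Ultrafilter.member U (λ k → k ≡ j)

Elems : (ℕ → Bool) → Set
Elems I = Σ ℕ (λ n → T (I n))

Infinite : (ℕ → Bool) → Set
Infinite I = ∀ (m : ℕ) → ∃ (λ n → m ≤ n × T (I n))

record RA : Set₂ where
  infixl 6 _⊕_
  infixl 7 _⨾_
  field
    Carrier : Set₁
    _≈_     : Carrier → Carrier → Set
    _⊕_     : Carrier → Carrier → Carrier
    ⁻_      : Carrier → Carrier
    1'      : Carrier
    _˘      : Carrier → Carrier
    _⨾_     : Carrier → Carrier → Carrier

record Embedding (A B : RA) : Set₁ where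
  private
    module A = RA A
    module B = RA B
  field
    h      : A.Carrier → B.Carrier
    h-cong : ∀ {x y} → x A.≈ y → h x B.≈ h y
    h-inj  : ∀ {x y} → h x B.≈ h y → x A.≈ y
    h-⊕    : ∀ x y → h (x A.⊕ y) B.≈ (h x B.⊕ h y)
    h-⁻    : ∀ x → h (A.⁻ x) B.≈ (B.⁻ h x)
    h-1'   : h A.1' B.≈ B.1'
    h-˘    : ∀ x → h (x A.˘) B.≈ (h x B.˘)
    h-⨾    : ∀ x y → h (x A.⨾ y) B.≈ (h x B.⨾ h y)

-- The atom set is a setoid S
-- (so that quotients such as ultraproducts can be used), with a
-- distinguished atom e playing the role of 1'; the diversity atoms are
-- the (classes of) atoms not equal to e.  Elements are the subsets of
-- the atom set, i.e. ≈-respecting predicates.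

module E13 (S : Setoid 0ℓ 0ℓ) (e : Setoid.Carrier S) where
  open Setoid S renaming (Carrier to At)

  -- c ≤ a ; b  for atoms a b c (table of E^{1,3})
  AtomComp : At → At → At → Set
  AtomComp a b c =
      (a ≈ e × c ≈ b)
    ⊎ (b ≈ e × c ≈ a)
    ⊎ (¬ a ≈ e × ¬ b ≈ e × a ≈ b × (c ≈ e ⊎ c ≈ a))
    ⊎ (¬ a ≈ e × ¬ b ≈ e × ¬ a ≈ b × ¬ c ≈ e × ¬ c ≈ a × ¬ c ≈ b)

  private
    ≈r : ∀ {c c' x} → c ≈ c' → c ≈ x → c' ≈ x
    ≈r p q = trans (sym p) q
    ≉r : ∀ {c c' x} → c ≈ c' → ¬ c ≈ x → ¬ c' ≈ x
    ≉r p q r = q (trans p r)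

  AtomComp-resp : ∀ {a b c c'} → c ≈ c' → AtomComp a b c → AtomComp a b c'
  AtomComp-resp p (inj₁ (x , y)) = inj₁ (x , ≈r p y)
  AtomComp-resp p (inj₂ (inj₁ (x , y))) = inj₂ (inj₁ (x , ≈r p y))
  AtomComp-resp p (inj₂ (inj₂ (inj₁ (x , y , z , w)))) =
    inj₂ (inj₂ (inj₁ (x , y , z , map (≈r p) (≈r p) w)))
  AtomComp-resp p (inj₂ (inj₂ (inj₂ (x , y , z , u , v , w)))) =
    inj₂ (inj₂ (inj₂ (x , y , z , ≉r p u , ≉r p v , ≉r p w)))

  record Subset : Set₁ where
    field
      _∋_  : At → Set
      resp : ∀ {a b} → a ≈ b → _∋_ a → _∋_ b
  open Subset public

  _≐_ : Subset → Subset → Set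
  X ≐ Y = ∀ a → ((X ∋ a) → (Y ∋ a)) × ((Y ∋ a) → (X ∋ a))

  _∪_ : Subset → Subset → Subset
  X ∪ Y = record { _∋_ = λ a → (X ∋ a) ⊎ (Y ∋ a)
                 ; resp = λ p → map (resp X p) (resp Y p) }

  ∁ : Subset → Subset
  ∁ X = record { _∋_ = λ a → ¬ (X ∋ a)
               ; resp = λ p q r → q (resp X (sym p) r) }

  one : Subset
  one = record { _∋_ = λ a → a ≈ e ; resp = λ p q → trans (sym p) q }

  _⨟_ : Subset → Subset → Subset
  X ⨟ Y = record
    { _∋_ = λ c → ∃ (λ a → ∃ (λ b → (X ∋ a) × (Y ∋ b) × AtomComp a b c))
    ; resp = λ { p (a , b , x , y , q) → a , b , x , y , AtomComp-resp p q } }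

  algebra : RA
  algebra = record
    { Carrier = Subset ; _≈_ = _≐_ ; _⊕_ = _∪_ ; ⁻_ = ∁ ; 1' = one
    ; _˘ = λ X → X ; _⨾_ = _⨟_ }

E13[_] : ℕ → RA
E13[ n ] = E13.algebra (≡.setoid (Fin (Data.Nat.suc n))) zero

module _ {J : Set} (U : Ultrafilter J) where
  open Ultrafilter U

  Ultraproduct : (J → RA) → RA
  Ultraproduct R = record
    { Carrier = (j : J) → RA.Carrier (R j)
    ; _≈_ = λ f g → member (λ j → RA._≈_ (R j) (f j) (g j))
    ; _⊕_ = λ f g j → RA._⊕_ (R j) (f j) (g j)
    ; ⁻_  = λ f j → RA.⁻_ (R j) (f j)
    ; 1'  = λ j → RA.1' (R j)
    ; _˘  = λ f j → RA._˘ (R j) (f j)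
    ; _⨾_ = λ f g j → RA._⨾_ (R j) (f j) (g j) }

  UltraSetoid : (A : J → Set) → Setoid 0ℓ 0ℓ
  UltraSetoid A = record
    { Carrier = (j : J) → A j
    ; _≈_ = λ f g → member (λ j → f j ≡ g j)
    ; isEquivalence = record
      { refl  = mono (λ _ _ → ≡.refl) full
      ; sym   = mono (λ _ → ≡.sym)
      ; trans = λ p q → mono (λ _ r → ≡.trans (proj₁ r) (proj₂ r)) (inter p q) } }

UltraE13 : (I : ℕ → Bool) → Ultrafilter (Elems I) → RA
UltraE13 I F = Ultraproduct F (λ j → E13[ proj₁ j ])

UltraAtoms : (I : ℕ → Bool) → Ultrafilter (Elems I) → Setoid 0ℓ 0ℓ
UltraAtoms I F = UltraSetoid F (λ j → Fin (Data.Nat.suc (proj₁ j)))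

BigE13 : (I : ℕ → Bool) → Ultrafilter (Elems I) → RA
BigE13 I F = E13.algebra (UltraAtoms I F) (λ _ → zero)

-- Łoś's theorem, read off atomwise: f in the ultraproduct is sent to the
-- set of ultraproduct atoms α with {j : α j ∈ f j} ∈ F.  Membership in the
-- operations of E^{1,3} is a boolean combination of memberships and atom
-- equalities under finite quantifiers in each factor, so Łoś's theorem
-- for ⊎, ¬ and finite ∃, ∀ makes the map a homomorphism and, via ∀, an
-- injective one.  Constructively, the ultrafilter decides constant
-- predicates, which yields weak excluded middle ¬ P ⊎ ¬ ¬ P; that is
-- enough to choose witnesses in the finite factors up to double negation,
-- and the ultrafilter absorbs the double negation.
module Submission where

open import Defs
open import Level using (Level)
open import Data.Nat using (ℕ; suc)
open import Data.Bool using (Bool)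
open import Data.Fin using (Fin; zero)
open import Data.Fin.Properties using (any?; ¬∀⟶∃¬; sequence)
open import Data.Product using (Σ-syntax; ∃; _×_; _,_; proj₁; proj₂; map₁; map₂)
open import Data.Sum using (_⊎_; inj₁; inj₂)
open import Data.Empty using (⊥-elim)
open import Effect.Monad using (RawMonad)
open import Function using (_∘_; id; const)
open import Relation.Nullary using (¬_; Dec; yes; no)
open import Relation.Nullary.Negation using (¬¬-Monad; negated-stable; contradiction)
open import Relation.Unary using (Pred; Decidable)
open import Relation.Binary.PropositionalEquality as ≡ using (subst)

private
  variable
    ℓ : Level

ε : ∀ {n} {P : Pred (Fin (suc n)) ℓ} → Decidable P → Σ[ a ∈ Fin (suc n) ] (∃ P → P a)
ε P? with any? P?
... | yes (a , p) = a , const p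
... | no ¬∃P      = zero , ⊥-elim ∘ ¬∃P

¬∀⟶∃¬-¬¬-dec : ∀ {n} {P : Pred (Fin n) ℓ} → (∀ i → Dec (¬ ¬ P i)) →
               ¬ (∀ i → P i) → ∃ λ i → ¬ P i
¬∀⟶∃¬-¬¬-dec {n = n} {P = P} ¬¬P? ¬∀P =
  map₂ negated-stable (¬∀⟶∃¬ n (¬_ ∘ ¬_ ∘ P) ¬¬P? λ ∀¬¬P → ¬¬-∀ ∀¬¬P ¬∀P)
  where
  ¬¬-∀ : (∀ i → ¬ ¬ P i) → ¬ ¬ (∀ i → P i)
  ¬¬-∀ = sequence (RawMonad.rawApplicative ¬¬-Monad)

module Łoś {J : Set} (U : Ultrafilter J) where
  open Ultrafilter U

  ¬⊎¬¬ : (P : Set) → ¬ P ⊎ ¬ ¬ P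
  ¬⊎¬¬ P with ultra (λ _ → P)
  ... | inj₁ m  = inj₂ λ ¬p → proper (mono (λ _ → ¬p) m)
  ... | inj₂ m¬ = inj₁ λ p → proper (mono (λ _ ¬p → ¬p p) m¬)

  ¬¬-dec : (P : Set) → Dec (¬ ¬ P)
  ¬¬-dec P with ¬⊎¬¬ P
  ... | inj₁ ¬p  = no (λ ¬¬p → ¬¬p ¬p)
  ... | inj₂ ¬¬p = yes ¬¬p

  module _ {X Y : J → Set} where
    member-× : member (λ j → X j × Y j) → member X × member Y
    member-× m = mono (λ _ → proj₁) m , mono (λ _ → proj₂) m

    member-⊎ : member (λ j → X j ⊎ Y j) → member X ⊎ member Y
    member-⊎ m with ultra X
    ... | inj₁ mX  = inj₁ mX
    ... | inj₂ m¬X = inj₂ (mono (λ { _ (inj₁ x , ¬x) → ⊥-elim (¬x x) ; _ (inj₂ y , _) → y })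
                                (inter m m¬X))

    ⊎-member : member X ⊎ member Y → member (λ j → X j ⊎ Y j)
    ⊎-member (inj₁ m) = mono (λ _ → inj₁) m
    ⊎-member (inj₂ m) = mono (λ _ → inj₂) m

    member-→ : (member X → member Y) → member (λ j → X j → Y j)
    member-→ k with ultra X
    ... | inj₁ mX  = mono (λ _ y _ → y) (k mX)
    ... | inj₂ m¬X = mono (λ _ ¬x x → ⊥-elim (¬x x)) m¬X

  ¬-member : {X : J → Set} → member (λ j → ¬ X j) → ¬ member X
  ¬-member m¬ m = proper (mono (λ _ (¬x , x) → ¬x x) (inter m¬ m))

  module _ {X : J → Set} where
    member-¬ : ¬ member X → member (λ j → ¬ X j)
    member-¬ ¬m with ultra X
    ... | inj₁ m  = contradiction m ¬m
    ... | inj₂ m¬ = m¬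

    member-¬¬ : member (λ j → ¬ ¬ X j) → member X
    member-¬¬ m¬¬ with ultra X
    ... | inj₁ m  = m
    ... | inj₂ m¬ = contradiction m¬ (¬-member m¬¬)

  member-¬× : {X Y : J → Set} → member (λ j → ¬ X j × Y j) → ¬ member X × member Y
  member-¬× = map₁ ¬-member ∘ member-×

  module _ {n : J → ℕ} where
    member-∃ : {P : (j : J) → Fin (suc (n j)) → Set} →
               member (λ j → ∃ (P j)) → ∃ λ α → member (λ j → P j (α j))
    member-∃ {P} m∃ = α , member-¬¬ (mono (λ j → proj₂ (choice j) ∘ map₂ λ p ¬p → ¬p p) m∃)
      where
      choice : ∀ j → Σ[ a ∈ Fin (suc (n j)) ] (∃ (¬_ ∘ ¬_ ∘ P j) → ¬ ¬ P j a)
      choice j = ε (λ a → ¬¬-dec (P j a))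
      α : ∀ j → Fin (suc (n j))
      α = proj₁ ∘ choice

    member-∀ : {P : (j : J) → Fin (suc (n j)) → Set} →
               (∀ α → member (λ j → P j (α j))) → member (λ j → ∀ a → P j a)
    member-∀ {P} ∀α with ultra (λ j → ∀ a → P j a)
    ... | inj₁ m  = m
    ... | inj₂ m¬ =
      let α , m¬α = member-∃ (mono (λ j → ¬∀⟶∃¬-¬¬-dec (λ a → ¬¬-dec (P j a))) m¬)
      in  contradiction (∀α α) (¬-member m¬α)

module _ {J : Set} (U : Ultrafilter J) (n : J → ℕ) where
  open Ultrafilter U
  open Łoś U

  Atom : J → Set
  Atom j = Fin (suc (n j))

  module Eⱼ (j : J) = E13 (≡.setoid (Atom j)) zero
  open E13.Subset using (_∋_)
  module Ω = E13 (UltraSetoid U Atom) (λ _ → zero)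

  ∏E13 : RA
  ∏E13 = Ultraproduct U (E13[_] ∘ n)

  member-AtomComp : ∀ {α β γ} →
                    member (λ j → Eⱼ.AtomComp j (α j) (β j) (γ j)) → Ω.AtomComp α β γ
  member-AtomComp m with member-⊎ m
  ... | inj₁ m₁ = inj₁ (member-× m₁)
  ... | inj₂ m₂ with member-⊎ m₂
  ... | inj₁ m₃ = inj₂ (inj₁ (member-× m₃))
  ... | inj₂ m₄ with member-⊎ m₄
  ... | inj₁ m₅ = inj₂ (inj₂ (inj₁
    (map₂ (map₂ (map₂ member-⊎ ∘ member-×) ∘ member-¬×) (member-¬× m₅))))
  ... | inj₂ m₆ = inj₂ (inj₂ (inj₂
    (map₂ (map₂ (map₂ (map₂ (map₂ ¬-member ∘ member-¬×) ∘ member-¬×) ∘ member-¬×) ∘ member-¬×)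
          (member-¬× m₆))))

  AtomComp-member : ∀ {α β γ} →
                    Ω.AtomComp α β γ → member (λ j → Eⱼ.AtomComp j (α j) (β j) (γ j))
  AtomComp-member (inj₁ (a≈e , c≈b)) = mono (λ _ → inj₁) (inter a≈e c≈b)
  AtomComp-member (inj₂ (inj₁ (b≈e , c≈a))) = mono (λ _ → inj₂ ∘ inj₁) (inter b≈e c≈a)
  AtomComp-member (inj₂ (inj₂ (inj₁ (a≉e , b≉e , a≈b , c≈e⊎c≈a)))) =
    mono (λ _ → inj₂ ∘ inj₂ ∘ inj₁)
      (inter (member-¬ a≉e) (inter (member-¬ b≉e) (inter a≈b (⊎-member c≈e⊎c≈a))))
  AtomComp-member (inj₂ (inj₂ (inj₂ (a≉e , b≉e , a≉b , c≉e , c≉a , c≉b)))) =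
    mono (λ _ → inj₂ ∘ inj₂ ∘ inj₂)
      (inter (member-¬ a≉e) (inter (member-¬ b≉e) (inter (member-¬ a≉b)
        (inter (member-¬ c≉e) (inter (member-¬ c≉a) (member-¬ c≉b))))))

  ι : RA.Carrier ∏E13 → Ω.Subset
  ι f = record
    { _∋_  = λ α → member (λ j → f j ∋ α j)
    ; resp = λ α≈β → mono (λ j (p , q) → subst (f j ∋_) p q) ∘ inter α≈β }

  ι-⨾-⊆ : ∀ f g γ → ι (RA._⨾_ ∏E13 f g) Ω.∋ γ → (ι f Ω.⨟ ι g) Ω.∋ γ
  ι-⨾-⊆ f g γ m =
    let α , mα   = member-∃ m
        β , mαβ  = member-∃ mα
        mf , mgc = member-× mαβ
        mg , mc  = member-× mgc
    in  α , β , mf , mg , member-AtomComp mc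

  ι-⨾-⊇ : ∀ f g γ → (ι f Ω.⨟ ι g) Ω.∋ γ → ι (RA._⨾_ ∏E13 f g) Ω.∋ γ
  ι-⨾-⊇ f g γ (α , β , mf , mg , ac) =
    mono (λ j x → α j , β j , x) (inter mf (inter mg (AtomComp-member ac)))

  ι-injective : ∀ {f g} → ι f Ω.≐ ι g → RA._≈_ ∏E13 f g
  ι-injective f≐g =
    member-∀ λ α → inter (member-→ (proj₁ (f≐g α))) (member-→ (proj₂ (f≐g α)))

  ultraproduct-E13-embedding : Embedding ∏E13 (E13.algebra (UltraSetoid U Atom) (λ _ → zero))
  ultraproduct-E13-embedding = record
    { h      = ι
    ; h-cong = λ f≐g α → mono (λ j (p , q) → proj₁ (p (α j)) q) ∘ inter f≐g
                       , mono (λ j (p , q) → proj₂ (p (α j)) q) ∘ inter f≐g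
    ; h-inj  = λ {f g} → ι-injective {f} {g}
    ; h-⊕    = λ _ _ _ → member-⊎ , ⊎-member
    ; h-⁻    = λ _ _ → ¬-member , member-¬
    ; h-1'   = λ _ → id , id
    ; h-˘    = λ _ _ → id , id
    ; h-⨾    = λ f g γ → ι-⨾-⊆ f g γ , ι-⨾-⊇ f g γ }

-- Infiniteness and non-principality only make the atom set of size 2^ω;
-- the embedding exists for every ultrafilter.
lemma4p2p3 : (I : ℕ → Bool) → Infinite I → (F : Ultrafilter (Elems I)) → NonPrincipal F →
    Embedding (UltraE13 I F) (BigE13 I F)
lemma4p2p3 I _ F _ = ultraproduct-E13-embedding F proj₁
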